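{- If $X$ is a totally balanced binary matrix, then $\mathcal{S}^Q(X)$ is totally balanced for every nonempty $Q\subseteq\operatorname{supp}(X)$.
   Context: For $X\in\{0,1\}^{m\times n}$, $\operatorname{supp}(X)=\{(i,j):x_{i,j}=1\}$. For $k\ge3$, $C_k$ denotes the $k\times k$ cycle matrix: a $k\times k$ binary matrix with exactly two $1$s in each row and column such that no proper submatrix has this property. $X$ is totally balanced if it has no submatrix equal (up to permutation of rows and columns) to $C_k$ for any $k\ge3$. Stretching: list $Q=\{q_1,\dots,q_t\}$, $q_s=(\ell_s,k_s)$, in non-decreasing order of row then column index; $\mathcal{S}^Q(X)$ is the $(m+t)\times(n+t)$ binary matrix with top-left block $X$, entries $1$ at $(\ell_s,n+s)$, $(m+s,k_s)$, $(m+s,n+s)$ for each $s\in[t]$, and all other entries $0$. -}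

module Defs where

open import Data.Nat using (ℕ; zero; suc; _+_; _<_; _≤_)
open import Data.Bool using (Bool; true; false; if_then_else_)
open import Data.Fin as F using (Fin; splitAt)
open import Data.Fin.Properties using () renaming (_≟_ to _≟F_)
open import Data.Product using (_×_; _,_; proj₁; proj₂; Σ; ∃)
open import Data.Sum using (_⊎_; inj₁; inj₂)
open import Relation.Nullary using (¬_; ⌊_⌋)
open import Relation.Binary.PropositionalEquality using (_≡_)
open import Function.Definitions using (Injective)

Mat : ℕ → ℕ → Set
Mat m n = Fin m → Fin n → Bool

countTrue : ∀ {n} → (Fin n → Bool) → ℕ
countTrue {zero}  f = 0
countTrue {suc n} f = (if f F.zero then 1 else 0) + countTrue (λ j → f (F.suc j))

TwoPerLine : ∀ {a b} → Mat a b → Set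
TwoPerLine {a} {b} Y =
  (∀ i → countTrue (λ j → Y i j) ≡ 2) × (∀ j → countTrue (λ i → Y i j) ≡ 2)

-- submatrix of Y selected by injective row/column maps (rows/columns may be permuted)
sub : ∀ {m n a b} → Mat m n → (Fin a → Fin m) → (Fin b → Fin n) → Mat a b
sub Y r c i j = Y (r i) (c j)

IsCycleMatrix : ∀ {k} → Mat k k → Set
IsCycleMatrix {k} Y =
  TwoPerLine Y ×
  (∀ a b (r : Fin (suc a) → Fin k) (c : Fin (suc b) → Fin k) →
     Injective _≡_ _≡_ r → Injective _≡_ _≡_ c →
     (suc a < k ⊎ suc b < k) →
     ¬ TwoPerLine (sub Y r c))

-- X contains a submatrix equal (up to row/column permutation) to some C_k, k ≥ 3
ContainsCycle : ∀ {m n} → Mat m n → Set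
ContainsCycle {m} {n} X =
  Σ ℕ λ k → 3 ≤ k × Σ (Fin k → Fin m) λ r → Σ (Fin k → Fin n) λ c →
    Injective _≡_ _≡_ r × Injective _≡_ _≡_ c × IsCycleMatrix (sub X r c)

TotallyBalanced : ∀ {m n} → Mat m n → Set
TotallyBalanced X = ¬ ContainsCycle X

_<ₗ_ : ∀ {m n} → Fin m × Fin n → Fin m × Fin n → Set
(i , j) <ₗ (i' , j') = (i F.< i') ⊎ ((i ≡ i') × (j F.< j'))

-- Q = {q_1,…,q_t} ⊆ supp X, listed in increasing (row, column) order
-- (strictly increasing, so the q_s are distinct and Q is a set)
SortedSupportList : ∀ {m n t} → Mat m n → (Fin t → Fin m × Fin n) → Set
SortedSupportList {t = t} X q =
  (∀ s → X (proj₁ (q s)) (proj₂ (q s)) ≡ true) ×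
  (∀ (s s' : Fin t) → s F.< s' → q s <ₗ q s')

-- the stretching S^Q(X); index m+s (resp. n+s) corresponds to inj₂ s of splitAt
stretch : ∀ {m n t} → Mat m n → (Fin t → Fin m × Fin n) → Mat (m + t) (n + t)
stretch {m} {n} X q i j with splitAt m i | splitAt n j
... | inj₁ a | inj₁ b = X a b
... | inj₁ a | inj₂ s = ⌊ a ≟F proj₁ (q s) ⌋
... | inj₂ s | inj₁ b = ⌊ b ≟F proj₂ (q s) ⌋
... | inj₂ s | inj₂ s' = ⌊ s ≟F s' ⌋

-- A cycle submatrix of S^Q(X) cannot use a new row m+s: its two 1s are at
-- columns k_s and n+s, whose 1s are in turn at rows ℓ_s and m+s, so the cycle
-- would contain the all-ones 2×2 block on rows {ℓ_s, m+s} and columns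
-- {k_s, n+s}, contradicting the minimality of a cycle of size k ≥ 3. The same
-- holds for new columns, so the cycle already lies in X.
module Submission where

open import Defs
open import Data.Nat using (ℕ; zero; suc; _+_; _≤_)
open import Data.Bool using (Bool; true; false)
open import Data.Bool.Properties using (T-≡)
open import Data.Empty using (⊥; ⊥-elim)
open import Data.Fin using (Fin; zero; suc; splitAt; join)
open import Data.Fin.Patterns using (0F; 1F)
open import Data.Fin.Properties using (join-splitAt; suc-injective)
  renaming (_≟_ to _≟F_)
import Data.Nat.Properties as ℕ
open import Data.Product using (_×_; _,_; proj₁; proj₂; ∃; ∃₂)
open import Data.Sum using (_⊎_; inj₁; inj₂)
open import Data.Vec.Functional using (_∷_; [])
open import Function using (_∘_)
open import Function.Bundles using (Equivalence)
open import Function.Definitions using (Injective)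
open import Relation.Nullary using (Dec; ⌊_⌋)
open import Relation.Nullary.Decidable using (dec-true; isYes≗does; toWitness)
open import Relation.Binary.PropositionalEquality

⌊⌋≡true⇒ : ∀ {A : Set} {a? : Dec A} → ⌊ a? ⌋ ≡ true → A
⌊⌋≡true⇒ e = toWitness (Equivalence.from T-≡ e)

≟F-refl : ∀ {n} (a : Fin n) → ⌊ a ≟F a ⌋ ≡ true
≟F-refl a = trans (isYes≗does (a ≟F a)) (dec-true (a ≟F a) refl)

splitAt-injective : ∀ m {n} → Injective _≡_ _≡_ (splitAt m {n})
splitAt-injective m {n} {x} {y} e =
  trans (sym (join-splitAt m n x)) (trans (cong (join m n) e) (join-splitAt m n y))

injective-through-inj₁ : ∀ {A B C : Set} {f : A → B ⊎ C} {g : A → B} →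
  Injective _≡_ _≡_ f → (∀ x → f x ≡ inj₁ (g x)) → Injective _≡_ _≡_ g
injective-through-inj₁ f-inj f≡inj₁∘g {x} {y} e =
  f-inj (trans (f≡inj₁∘g x) (trans (cong inj₁ e) (sym (f≡inj₁∘g y))))

pair-injective : ∀ {A : Set} {x y : A} → x ≢ y → Injective _≡_ _≡_ (x ∷ y ∷ [])
pair-injective x≢y {0F} {0F} _ = refl
pair-injective x≢y {0F} {1F} e = ⊥-elim (x≢y e)
pair-injective x≢y {1F} {0F} e = ⊥-elim (x≢y (sym e))
pair-injective x≢y {1F} {1F} _ = refl

countTrue-cong : ∀ {n} {f g : Fin n → Bool} → (∀ j → f j ≡ g j) → countTrue f ≡ countTrue g
countTrue-cong {zero}  f≗g = refl
countTrue-cong {suc n} f≗g rewrite f≗g zero = cong (_ +_) (countTrue-cong (f≗g ∘ suc))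

countTrue≡1⇒∃ : ∀ {n} (f : Fin n → Bool) → countTrue f ≡ 1 → ∃ λ j → f j ≡ true
countTrue≡1⇒∃ {suc n} f e with f zero in f₀
... | true  = zero , f₀
... | false = let j , fj = countTrue≡1⇒∃ (f ∘ suc) e in suc j , fj

countTrue≡2⇒∃₂ : ∀ {n} (f : Fin n → Bool) → countTrue f ≡ 2 →
  ∃₂ λ j j′ → j ≢ j′ × f j ≡ true × f j′ ≡ true
countTrue≡2⇒∃₂ {suc n} f e with f zero in f₀
... | true  = let j , fj = countTrue≡1⇒∃ (f ∘ suc) (ℕ.suc-injective e) in
  zero , suc j , (λ ()) , f₀ , fj
... | false = let j , j′ , j≢j′ , fj , fj′ = countTrue≡2⇒∃₂ (f ∘ suc) e in
  suc j , suc j′ , j≢j′ ∘ suc-injective , fj , fj′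

countTrue-pair : (f : Fin 2 → Bool) → f 0F ≡ true → f 1F ≡ true → countTrue f ≡ 2
countTrue-pair f f₀ f₁ rewrite f₀ | f₁ = refl

countTrue≡2-covers : ∀ {n} {A : Set} (f : Fin n → A) → Injective _≡_ _≡_ f →
  (g : Fin n → Bool) → countTrue g ≡ 2 → {u v : A} →
  (∀ j → g j ≡ true → f j ≡ u ⊎ f j ≡ v) →
  (∃ λ j → f j ≡ u) × (∃ λ j → f j ≡ v)
countTrue≡2-covers f f-inj g e label with countTrue≡2⇒∃₂ g e
... | j , j′ , j≢j′ , gj , gj′ with label j gj | label j′ gj′
... | inj₁ fj | inj₁ fj′ = ⊥-elim (j≢j′ (f-inj (trans fj (sym fj′))))
... | inj₁ fj | inj₂ fj′ = (j , fj) , (j′ , fj′)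
... | inj₂ fj | inj₁ fj′ = (j′ , fj′) , (j , fj)
... | inj₂ fj | inj₂ fj′ = ⊥-elim (j≢j′ (f-inj (trans fj (sym fj′))))

TwoPerLine-cong : ∀ {a b} {Y Y′ : Mat a b} → (∀ i j → Y i j ≡ Y′ i j) →
  TwoPerLine Y → TwoPerLine Y′
TwoPerLine-cong Y≗Y′ (rows , cols) =
  (λ i → trans (sym (countTrue-cong (Y≗Y′ i))) (rows i)) ,
  (λ j → trans (sym (countTrue-cong (λ i → Y≗Y′ i j))) (cols j))

IsCycleMatrix-cong : ∀ {k} {Y Y′ : Mat k k} → (∀ i j → Y i j ≡ Y′ i j) →
  IsCycleMatrix Y → IsCycleMatrix Y′
IsCycleMatrix-cong Y≗Y′ (twoPerLine , minimal) =
  TwoPerLine-cong Y≗Y′ twoPerLine ,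
  λ a b r c r-inj c-inj proper →
    minimal a b r c r-inj c-inj proper ∘ TwoPerLine-cong (λ i j → sym (Y≗Y′ (r i) (c j)))

IsCycleMatrix⇒¬all-ones-2×2 : ∀ {k} {Y : Mat k k} → 3 ≤ k → IsCycleMatrix Y →
  ∀ {i i′ j j′} → i ≢ i′ → j ≢ j′ →
  Y i j ≡ true → Y i j′ ≡ true → Y i′ j ≡ true → Y i′ j′ ≡ true → ⊥
IsCycleMatrix⇒¬all-ones-2×2 {k} {Y} 3≤k (_ , minimal) {i} {i′} {j} {j′} i≢i′ j≢j′ yᵢⱼ yᵢⱼ′ yᵢ′ⱼ yᵢ′ⱼ′ =
  minimal 1 1 rs cs (pair-injective i≢i′) (pair-injective j≢j′) (inj₁ 3≤k) (rows , cols)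
  where
  rs cs : Fin 2 → Fin k
  rs = i ∷ i′ ∷ []
  cs = j ∷ j′ ∷ []
  rows : ∀ a → countTrue (λ b → sub Y rs cs a b) ≡ 2
  rows 0F = countTrue-pair (sub Y rs cs 0F) yᵢⱼ yᵢⱼ′
  rows 1F = countTrue-pair (sub Y rs cs 1F) yᵢ′ⱼ yᵢ′ⱼ′
  cols : ∀ b → countTrue (λ a → sub Y rs cs a b) ≡ 2
  cols 0F = countTrue-pair (λ a → sub Y rs cs a 0F) yᵢⱼ yᵢ′ⱼ
  cols 1F = countTrue-pair (λ a → sub Y rs cs a 1F) yᵢⱼ′ yᵢ′ⱼ′

stretchBlocks : ∀ {m n t} → Mat m n → (Fin t → Fin m × Fin n) →
  Fin m ⊎ Fin t → Fin n ⊎ Fin t → Bool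
stretchBlocks X q (inj₁ a) (inj₁ b)  = X a b
stretchBlocks X q (inj₁ a) (inj₂ s)  = ⌊ a ≟F proj₁ (q s) ⌋
stretchBlocks X q (inj₂ s) (inj₁ b)  = ⌊ b ≟F proj₂ (q s) ⌋
stretchBlocks X q (inj₂ s) (inj₂ s′) = ⌊ s ≟F s′ ⌋

stretch≡stretchBlocks : ∀ {m n t} (X : Mat m n) (q : Fin t → Fin m × Fin n) i j →
  stretch X q i j ≡ stretchBlocks X q (splitAt m i) (splitAt n j)
stretch≡stretchBlocks {m} {n} X q i j with splitAt m i | splitAt n j
... | inj₁ a | inj₁ b  = refl
... | inj₁ a | inj₂ s  = refl
... | inj₂ s | inj₁ b  = refl
... | inj₂ s | inj₂ s′ = refl

stretchBlocks-newRow : ∀ {m n t} (X : Mat m n) (q : Fin t → Fin m × Fin n) {s} w →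
  stretchBlocks X q (inj₂ s) w ≡ true → w ≡ inj₁ (proj₂ (q s)) ⊎ w ≡ inj₂ s
stretchBlocks-newRow X q (inj₁ b)  e = inj₁ (cong inj₁ (⌊⌋≡true⇒ e))
stretchBlocks-newRow X q (inj₂ s′) e = inj₂ (cong inj₂ (sym (⌊⌋≡true⇒ e)))

stretchBlocks-newCol : ∀ {m n t} (X : Mat m n) (q : Fin t → Fin m × Fin n) {s} w →
  stretchBlocks X q w (inj₂ s) ≡ true → w ≡ inj₁ (proj₁ (q s)) ⊎ w ≡ inj₂ s
stretchBlocks-newCol X q (inj₁ a)  e = inj₁ (cong inj₁ (⌊⌋≡true⇒ e))
stretchBlocks-newCol X q (inj₂ s′) e = inj₂ (cong inj₂ (⌊⌋≡true⇒ e))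

module CycleInStretch {m n t} (X : Mat m n) (q : Fin t → Fin m × Fin n)
  (q⊆supp : ∀ s → X (proj₁ (q s)) (proj₂ (q s)) ≡ true)
  {k} (3≤k : 3 ≤ k) (r : Fin k → Fin (m + t)) (c : Fin k → Fin (n + t))
  (r-inj : Injective _≡_ _≡_ r) (c-inj : Injective _≡_ _≡_ c)
  (cycle : IsCycleMatrix (sub (stretch X q) r c)) where

  Y : Mat k k
  Y = sub (stretch X q) r c

  row : Fin k → Fin m ⊎ Fin t
  row = splitAt m ∘ r

  col : Fin k → Fin n ⊎ Fin t
  col = splitAt n ∘ c

  row-injective : Injective _≡_ _≡_ row
  row-injective = r-inj ∘ splitAt-injective m

  col-injective : Injective _≡_ _≡_ col
  col-injective = c-inj ∘ splitAt-injective n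

  entry : ∀ {i j u v} → row i ≡ u → col j ≡ v →
    Y i j ≡ stretchBlocks X q u v
  entry {i} {j} refl refl = stretch≡stretchBlocks X q (r i) (c j)

  newRow-covers : ∀ {i s} → row i ≡ inj₂ s →
    (∃ λ j → col j ≡ inj₁ (proj₂ (q s))) × (∃ λ j → col j ≡ inj₂ s)
  newRow-covers {i} rowᵢ = countTrue≡2-covers col col-injective (Y i) (proj₁ (proj₁ cycle) i)
    λ j Yᵢⱼ → stretchBlocks-newRow X q (col j) (trans (sym (entry rowᵢ refl)) Yᵢⱼ)

  newCol-covers : ∀ {j s} → col j ≡ inj₂ s →
    (∃ λ i → row i ≡ inj₁ (proj₁ (q s))) × (∃ λ i → row i ≡ inj₂ s)
  newCol-covers {j} colⱼ = countTrue≡2-covers row row-injective (λ i → Y i j) (proj₂ (proj₁ cycle) j)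
    λ i Yᵢⱼ → stretchBlocks-newCol X q (row i) (trans (sym (entry refl colⱼ)) Yᵢⱼ)

  no-square : ∀ {s i i′ j j′} →
    row i ≡ inj₁ (proj₁ (q s)) → row i′ ≡ inj₂ s →
    col j ≡ inj₁ (proj₂ (q s)) → col j′ ≡ inj₂ s → ⊥
  no-square {s} rowᵢ rowᵢ′ colⱼ colⱼ′ =
    IsCycleMatrix⇒¬all-ones-2×2 3≤k cycle
      (λ i≡i′ → inj₁≢inj₂ (trans (sym rowᵢ) (trans (cong row i≡i′) rowᵢ′)))
      (λ j≡j′ → inj₁≢inj₂ (trans (sym colⱼ) (trans (cong col j≡j′) colⱼ′)))
      (trans (entry rowᵢ colⱼ) (q⊆supp s))
      (trans (entry rowᵢ colⱼ′) (≟F-refl (proj₁ (q s))))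
      (trans (entry rowᵢ′ colⱼ) (≟F-refl (proj₂ (q s))))
      (trans (entry rowᵢ′ colⱼ′) (≟F-refl s))
    where
    inj₁≢inj₂ : ∀ {A B : Set} {a : A} {b : B} → inj₁ a ≢ inj₂ b
    inj₁≢inj₂ ()

  no-newCol : ∀ {j s} → col j ≢ inj₂ s
  no-newCol colⱼ =
    let (_ , rowᵢ) , (_ , rowᵢ′) = newCol-covers colⱼ
        (_ , colⱼ′) , _ = newRow-covers rowᵢ′
    in no-square rowᵢ rowᵢ′ colⱼ′ colⱼ

  no-newRow : ∀ {i s} → row i ≢ inj₂ s
  no-newRow rowᵢ = no-newCol (proj₂ (proj₂ (newRow-covers rowᵢ)))

  oldRow : ∀ i → ∃ λ a → row i ≡ inj₁ a
  oldRow i with row i in rowᵢ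
  ... | inj₁ a = a , refl
  ... | inj₂ s = ⊥-elim (no-newRow rowᵢ)

  oldCol : ∀ j → ∃ λ b → col j ≡ inj₁ b
  oldCol j with col j in colⱼ
  ... | inj₁ b = b , refl
  ... | inj₂ s = ⊥-elim (no-newCol colⱼ)

  cycle-in-X : ContainsCycle X
  cycle-in-X =
    k , 3≤k , proj₁ ∘ oldRow , proj₁ ∘ oldCol ,
    injective-through-inj₁ row-injective (proj₂ ∘ oldRow) ,
    injective-through-inj₁ col-injective (proj₂ ∘ oldCol) ,
    IsCycleMatrix-cong (λ i j → entry (proj₂ (oldRow i)) (proj₂ (oldCol j))) cycle

stretch-cycle⇒cycle : ∀ {m n t} (X : Mat m n) (q : Fin t → Fin m × Fin n) →
  (∀ s → X (proj₁ (q s)) (proj₂ (q s)) ≡ true) →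
  ContainsCycle (stretch X q) → ContainsCycle X
stretch-cycle⇒cycle X q q⊆supp (k , 3≤k , r , c , r-inj , c-inj , cycle) =
  CycleInStretch.cycle-in-X X q q⊆supp 3≤k r c r-inj c-inj cycle

lemma3 : ∀ {m n} (X : Mat m n) → TotallyBalanced X →
    ∀ (t : ℕ) (q : Fin (suc t) → Fin m × Fin n) → SortedSupportList X q →
    TotallyBalanced (stretch X q)
lemma3 X balanced t q (q⊆supp , _) = balanced ∘ stretch-cycle⇒cycle X q q⊆supp
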